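{- Let $p$ be an even positive integer and $\tau,i,j$ non-negative integers. Let $\mu=\frac{p^2}{4}+2p+2$, $\gamma=2\mu-\left(\frac p2+4\right)$, $m=\mu+\tau\frac p2$, $g=\gamma+\tau(p-1)$, $c=p\mu+\tau\left(\frac{p^2}{2}-1\right)$, $S(p,\tau)=\langle m,g,g+1\rangle_c$; and let $m^{(i,j)}=m+j\frac p2$, $g^{(i,j)}=g+j(p-1)+i\,m^{(i,j)}$, $c^{(i,j)}=c+j\frac{p^2}{2}+i\left(\frac p2+1\right)m^{(i,j)}$, $S^{(i,j)}(p,\tau)=\langle m^{(i,j)},g^{(i,j)},g^{(i,j)}+1\rangle_{c^{(i,j)}}$. Then the conductor of $S^{(i,j)}(p,\tau)$ is $$c(S(p,\tau))+j\frac{p^2}{2}+i\left(\frac p2+1\right)\left(m+j\frac p2\right).$$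
   Context: A numerical semigroup is a submonoid of $(\mathbb N,+)$ with finite complement. For integers $a_1,\dots,a_r$ and $t$, $\langle a_1,\dots,a_r\rangle_t$ denotes the smallest numerical semigroup containing $a_1,\dots,a_r$ and all integers $\ge t$. The conductor $c(S)$ of a numerical semigroup $S$ is the smallest integer such that all integers $\ge c(S)$ belong to $S$. -}

module Defs where

open import Data.Nat using (ℕ; _+_; _*_; _∸_; _≤_)
open import Data.Nat.DivMod using (_/_)
open import Data.Product using (Σ; _×_; ∃-syntax)
open import Data.Sum using (_⊎_)
open import Relation.Binary.PropositionalEquality using (_≡_)

-- Membership in ⟨a₁,a₂,a₃⟩_t : the smallest numerical semigroup containing
-- a₁, a₂, a₃ and all integers ≥ t.  Its elements are exactly the
-- non-negative integer combinations of a₁,a₂,a₃ together with all x ≥ t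
-- (any sum involving an element ≥ t is itself ≥ t).
Gen3 : ℕ → ℕ → ℕ → ℕ → ℕ → Set
Gen3 a₁ a₂ a₃ t x = t ≤ x ⊎ ∃[ k ] ∃[ l ] ∃[ n ] (x ≡ k * a₁ + l * a₂ + n * a₃)

IsConductor : (ℕ → Set) → ℕ → Set
IsConductor S c = (∀ x → c ≤ x → S x) × (∀ c' → (∀ x → c' ≤ x → S x) → c ≤ c')

-- Parameters (p even, so all divisions below are exact).
μ : ℕ → ℕ
μ p = (p * p) / 4 + 2 * p + 2

γ : ℕ → ℕ
γ p = 2 * μ p ∸ (p / 2 + 4)

mP : ℕ → ℕ → ℕ
mP p τ = μ p + τ * (p / 2)

gP : ℕ → ℕ → ℕ
gP p τ = γ p + τ * (p ∸ 1)

cP : ℕ → ℕ → ℕ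
cP p τ = p * μ p + τ * ((p * p) / 2 ∸ 1)

S : ℕ → ℕ → ℕ → Set
S p τ = Gen3 (mP p τ) (gP p τ) (gP p τ + 1) (cP p τ)

mIJ : ℕ → ℕ → ℕ → ℕ → ℕ
mIJ p τ i j = mP p τ + j * (p / 2)

gIJ : ℕ → ℕ → ℕ → ℕ → ℕ
gIJ p τ i j = gP p τ + j * (p ∸ 1) + i * mIJ p τ i j

cIJ : ℕ → ℕ → ℕ → ℕ → ℕ
cIJ p τ i j = cP p τ + j * ((p * p) / 2) + i * (p / 2 + 1) * mIJ p τ i j

SIJ : ℕ → ℕ → ℕ → ℕ → ℕ → Set
SIJ p τ i j = Gen3 (mIJ p τ i j) (gIJ p τ i j) (gIJ p τ i j + 1) (cIJ p τ i j)

-- Write m, g, c for m^(i,j), g^(i,j), c^(i,j), and put h = p/2, d = h + 4 + τ + j and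
-- A = p + i(h+1).  Then g + d = (2+i) m, h d + 2 = m and c + τ = A m.  Every integer ≥ c
-- lies in the semigroup, so c is its conductor once c - 1 is not k m + l g + n (g+1), i.e.
-- not k m + s g + n with n ≤ s = l + n.  If s > h, already (h+1) g = A m + m + 2 - d exceeds
-- c - 1 = A m - τ - 1, because d ≤ m.  If s ≤ h, adding s d turns the s copies of g into
-- multiples of m, so s d ≡ n + τ + 1 (mod m) with both sides below m; but s d > s + τ + 1
-- since d ≥ τ + 3.  For i = j = 0 this identifies c(S(p,τ)) with c, giving the formula.

module Submission where

open import Defs
open import Data.Nat using (ℕ; zero; suc; _+_; _*_; _∸_; _≤_; _<_; _≤?_; _<?_; z≤n; z<s; NonZero; >-nonZero)
open import Data.Nat.Properties
open import Data.Nat.DivMod using (_/_; _%_; m*n/n≡m; m/n*n≡m; m<n⇒m%n≡m; [m+kn]%n≡m%n)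
open import Data.Nat.Divisibility using (_∣_)
open import Data.Nat.Tactic.RingSolver using (solve)
open import Data.List using (_∷_; [])
open import Data.Product using (_,_; ∃-syntax)
open import Data.Sum using (inj₁; inj₂)
open import Relation.Nullary using (¬_; yes; no; contradiction)
open import Relation.Binary.PropositionalEquality

Combination : ℕ → ℕ → ℕ → ℕ → Set
Combination a₁ a₂ a₃ x = ∃[ k ] ∃[ l ] ∃[ n ] (x ≡ k * a₁ + l * a₂ + n * a₃)

IsConductor-unique : ∀ {P : ℕ → Set} {a b} → IsConductor P a → IsConductor P b → a ≡ b
IsConductor-unique (a-works , a-least) (b-works , b-least) = ≤-antisym (a-least _ b-works) (b-least _ a-works)

Gen3-conductor : ∀ {a₁ a₂ a₃} t → (∀ x → suc x ≡ t → ¬ Combination a₁ a₂ a₃ x) →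
  IsConductor (Gen3 a₁ a₂ a₃ t) t
Gen3-conductor zero    _   = (λ _ → inj₁) , λ _ _ → z≤n
Gen3-conductor {a₁} {a₂} {a₃} (suc x) gap = (λ _ → inj₁) , least
  where
  least : ∀ c → (∀ y → c ≤ y → Gen3 a₁ a₂ a₃ (suc x) y) → suc x ≤ c
  least c above with suc x ≤? c
  ... | yes x<c = x<c
  ... | no x≮c with above x (≤-pred (≰⇒> x≮c))
  ...   | inj₁ x<x = contradiction x<x (n≮n x)
  ...   | inj₂ comb = contradiction comb (gap x refl)

remainder-unique : ∀ a k {b c M} → a * M + b ≡ k * M + c → b < M → c < M → b ≡ c
remainder-unique a k {b} {c} {M@(suc _)} eq b<M c<M = begin
  b                ≡⟨ m<n⇒m%n≡m b<M ⟨
  b % M            ≡⟨ [m+kn]%n≡m%n b a M ⟨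
  (b + a * M) % M  ≡⟨ cong (_% M) (trans (+-comm b (a * M)) (trans eq (+-comm (k * M) c))) ⟩
  (c + k * M) % M  ≡⟨ [m+kn]%n≡m%n c k M ⟩
  c % M            ≡⟨ m<n⇒m%n≡m c<M ⟩
  c                ∎
  where open ≡-Reasoning

product≢small-sum : ∀ s {n d τ} → n ≤ s → 3 + τ ≤ d → s * d ≢ n + suc τ
product≢small-sum zero z≤n _ ()
product≢small-sum (suc s) {n} {d} {τ} n≤s 3+τ≤d eq = <-irrefl (sym eq) (begin-strict
  n + suc τ        ≤⟨ +-monoˡ-≤ (suc τ) n≤s ⟩
  suc s + suc τ    <⟨ ≤-reflexive (solve (s ∷ τ ∷ [])) ⟩
  3 + τ + s        ≤⟨ +-mono-≤ 3+τ≤d (m≤m*n s d ⦃ >-nonZero (<-≤-trans z<s 3+τ≤d) ⦄) ⟩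
  d + s * d        ∎)
  where open ≤-Reasoning

module _ {M G d q i τ : ℕ} .⦃ _ : NonZero q ⦄
         (G+d≡ : G + d ≡ (2 + i) * M) (q*d+2≡M : q * d + 2 ≡ M) (3+τ≤d : 3 + τ ≤ d) where

  private
    d≤M : d ≤ M
    d≤M = ≤-trans (m≤n*m d q) (≤-trans (m≤m+n (q * d) 2) (≤-reflexive q*d+2≡M))

    q*d<M : q * d < M
    q*d<M = <-≤-trans (m<m+n (q * d) z<s) (≤-reflexive q*d+2≡M)

    q+1+τ<M : q + suc τ < M
    q+1+τ<M = begin-strict
      q + suc τ          ≤⟨ +-monoʳ-≤ q (m≤n*m (suc τ) q) ⟩
      q + q * suc τ      ≡⟨ *-suc q (suc τ) ⟨
      q * (2 + τ)        ≤⟨ *-monoʳ-≤ q (<⇒≤ 3+τ≤d) ⟩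
      q * d              <⟨ q*d<M ⟩
      M                  ∎
      where open ≤-Reasoning

    q+1-copies : (1 + q) * G + d ≡ (i * (q + 1) + 2 * q) * M + M + 2
    q+1-copies = +-cancelʳ-≡ M _ _ (begin
      (1 + q) * G + d + M                ≡⟨ cong ((1 + q) * G + d +_) q*d+2≡M ⟨
      (1 + q) * G + d + (q * d + 2)      ≡⟨ solve (q ∷ G ∷ d ∷ []) ⟩
      (1 + q) * (G + d) + 2              ≡⟨ cong (λ y → (1 + q) * y + 2) G+d≡ ⟩
      (1 + q) * ((2 + i) * M) + 2        ≡⟨ solve (q ∷ i ∷ M ∷ []) ⟩
      (i * (q + 1) + 2 * q) * M + M + 2 + M ∎)
      where open ≡-Reasoning

    ¬regrouped-many : ∀ k s n → q < s → k * M + s * G + n + suc τ ≢ (i * (q + 1) + 2 * q) * M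
    ¬regrouped-many k s n q<s eq = ≤⇒≯ d≤M (+-cancelˡ-< (A * M) M d (begin-strict
      A * M + M              <⟨ m<m+n (A * M + M) z<s ⟩
      A * M + M + 2          ≡⟨ q+1-copies ⟨
      (1 + q) * G + d        ≤⟨ +-monoˡ-≤ d (≤-trans (*-monoˡ-≤ G q<s) s*G≤x) ⟩
      x + d                  ≤⟨ +-monoˡ-≤ d (m≤m+n x (suc τ)) ⟩
      x + suc τ + d          ≡⟨ cong (_+ d) eq ⟩
      A * M + d              ∎))
      where
      open ≤-Reasoning
      A = i * (q + 1) + 2 * q
      x = k * M + s * G + n
      s*G≤x : s * G ≤ x
      s*G≤x = ≤-trans (m≤n+m (s * G) (k * M)) (m≤m+n _ n)

    ¬regrouped-few : ∀ k s n → s ≤ q → n ≤ s → k * M + s * G + n + suc τ ≢ (i * (q + 1) + 2 * q) * M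
    ¬regrouped-few k s n s≤q n≤s eq =
      product≢small-sum s n≤s 3+τ≤d (remainder-unique (i * (q + 1) + 2 * q) (k + s * (2 + i)) shifted s*d<M n+1+τ<M)
      where
      open ≡-Reasoning
      shifted : (i * (q + 1) + 2 * q) * M + s * d ≡ (k + s * (2 + i)) * M + (n + suc τ)
      shifted = begin
        (i * (q + 1) + 2 * q) * M + s * d        ≡⟨ cong (_+ s * d) eq ⟨
        k * M + s * G + n + suc τ + s * d        ≡⟨ solve (k ∷ s ∷ n ∷ τ ∷ M ∷ G ∷ d ∷ []) ⟩
        k * M + s * (G + d) + (n + suc τ)        ≡⟨ cong (λ y → k * M + s * y + (n + suc τ)) G+d≡ ⟩
        k * M + s * ((2 + i) * M) + (n + suc τ)  ≡⟨ solve (k ∷ s ∷ n ∷ τ ∷ M ∷ i ∷ []) ⟩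
        (k + s * (2 + i)) * M + (n + suc τ)      ∎
      s*d<M : s * d < M
      s*d<M = ≤-<-trans (*-monoˡ-≤ d s≤q) q*d<M
      n+1+τ<M : n + suc τ < M
      n+1+τ<M = ≤-<-trans (+-monoˡ-≤ (suc τ) (≤-trans n≤s s≤q)) q+1+τ<M

    ¬regrouped : ∀ k s n → n ≤ s → k * M + s * G + n + suc τ ≢ (i * (q + 1) + 2 * q) * M
    ¬regrouped k s n n≤s with q <? s
    ... | yes q<s = ¬regrouped-many k s n q<s
    ... | no q≮s  = ¬regrouped-few k s n (≮⇒≥ q≮s) n≤s

  consecutive-gap : ∀ {x} → x + suc τ ≡ (i * (q + 1) + 2 * q) * M → ¬ Combination M G (G + 1) x
  consecutive-gap x+1+τ≡ (k , l , n , refl) =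
    ¬regrouped k (l + n) n (m≤n+m n l) (trans (cong (_+ suc τ) regroup) x+1+τ≡)
    where
    regroup : k * M + (l + n) * G + n ≡ k * M + l * G + n * (G + 1)
    regroup = solve (k ∷ l ∷ n ∷ M ∷ G ∷ [])

  consecutive-conductor : ∀ {C} → C + τ ≡ (i * (q + 1) + 2 * q) * M → IsConductor (Gen3 M G (G + 1) C) C
  consecutive-conductor C+τ≡ = Gen3-conductor _ λ x 1+x≡C →
    consecutive-gap (trans (+-suc x τ) (trans (cong (_+ τ) 1+x≡C) C+τ≡))

dIJ : ℕ → ℕ → ℕ → ℕ
dIJ p τ j = p / 2 + 4 + τ + j

double-square/4 : ∀ h → h * 2 * (h * 2) / 4 ≡ h * h
double-square/4 h = trans (cong (_/ 4) square) (m*n/n≡m (h * h) 4)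
  where
  square : h * 2 * (h * 2) ≡ h * h * 4
  square = solve (h ∷ [])

double-square/2 : ∀ h → h * 2 * (h * 2) / 2 ≡ h * 2 * h
double-square/2 h = trans (cong (_/ 2) (sym (*-assoc (h * 2) h 2))) (m*n/n≡m (h * 2 * h) 2)

module _ {p : ℕ} (2∣p : 2 ∣ p) where

  p/2*2≡p : p / 2 * 2 ≡ p
  p/2*2≡p = m/n*n≡m 2∣p

  μ-even : μ p ≡ p / 2 * (p / 2) + 2 * p + 2
  μ-even = cong (λ x → x + 2 * p + 2) (subst (λ x → x * x / 4 ≡ p / 2 * (p / 2)) p/2*2≡p (double-square/4 (p / 2)))

  p*p/2≡p*[p/2] : p * p / 2 ≡ p * (p / 2)
  p*p/2≡p*[p/2] = subst (λ x → x * x / 2 ≡ x * (p / 2)) p/2*2≡p (double-square/2 (p / 2))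

  γ-even : γ p + (p / 2 + 4) ≡ 2 * μ p
  γ-even = m∸n+n≡m (subst (p / 2 + 4 ≤_) (cong (2 *_) (sym μ-even)) (half+4≤ (p / 2) p/2*2≡p))
    where
    half+4≤ : ∀ h {n} → h * 2 ≡ n → h + 4 ≤ 2 * (h * h + 2 * n + 2)
    half+4≤ h refl = begin
      h + 4                                ≤⟨ m≤m+n (h + 4) (h * h * 2 + 7 * h) ⟩
      h + 4 + (h * h * 2 + 7 * h)          ≡⟨ solve (h ∷ []) ⟩
      2 * (h * h + 2 * (h * 2) + 2)        ∎
      where open ≤-Reasoning

  module _ (0<p : 0 < p) (τ i j : ℕ) where

    p/2≢0 : NonZero (p / 2)
    p/2≢0 = m*n≢0⇒m≢0 (p / 2) ⦃ subst NonZero (sym p/2*2≡p) (>-nonZero 0<p) ⦄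

    gIJ+dIJ≡ : gIJ p τ i j + dIJ p τ j ≡ (2 + i) * mIJ p τ i j
    gIJ+dIJ≡ = polynomial (p / 2) (γ p) (μ p) (p ∸ 1) p/2*2≡p γ-even (suc-pred p ⦃ >-nonZero 0<p ⦄)
      where
      polynomial : ∀ {n} h γ μ u → h * 2 ≡ n → γ + (h + 4) ≡ 2 * μ → suc u ≡ n →
        γ + τ * u + j * u + i * (μ + τ * h + j * h) + (h + 4 + τ + j) ≡ (2 + i) * (μ + τ * h + j * h)
      polynomial h γ μ u refl γ+h+4≡ 1+u≡ = begin
        γ + τ * u + j * u + i * (μ + τ * h + j * h) + (h + 4 + τ + j)
          ≡⟨ solve (h ∷ μ ∷ γ ∷ u ∷ τ ∷ i ∷ j ∷ []) ⟩
        γ + (h + 4) + (τ + j) * suc u + i * (μ + τ * h + j * h)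
          ≡⟨ cong₂ (λ a b → a + (τ + j) * b + i * (μ + τ * h + j * h)) γ+h+4≡ 1+u≡ ⟩
        2 * μ + (τ + j) * (h * 2) + i * (μ + τ * h + j * h)
          ≡⟨ solve (h ∷ μ ∷ τ ∷ i ∷ j ∷ []) ⟩
        (2 + i) * (μ + τ * h + j * h)
          ∎
        where open ≡-Reasoning

    p/2*dIJ+2≡mIJ : p / 2 * dIJ p τ j + 2 ≡ mIJ p τ i j
    p/2*dIJ+2≡mIJ = polynomial (p / 2) (μ p) p/2*2≡p μ-even
      where
      polynomial : ∀ {n} h μ → h * 2 ≡ n → μ ≡ h * h + 2 * n + 2 → h * (h + 4 + τ + j) + 2 ≡ μ + τ * h + j * h
      polynomial h μ refl refl = solve (h ∷ τ ∷ j ∷ [])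

    cIJ+τ≡ : cIJ p τ i j + τ ≡ (i * (p / 2 + 1) + 2 * (p / 2)) * mIJ p τ i j
    cIJ+τ≡ = polynomial (p / 2) (μ p) (p * p / 2) (p * p / 2 ∸ 1) (sym p/2*2≡p) p*p/2≡p*[p/2]
      (suc-pred (p * p / 2) ⦃ subst NonZero (sym p*p/2≡p*[p/2]) (m*n≢0 p (p / 2) ⦃ >-nonZero 0<p ⦄ ⦃ p/2≢0 ⦄) ⦄)
      where
      polynomial : ∀ {n} h μ s w → n ≡ h * 2 → s ≡ n * h → suc w ≡ s →
        n * μ + τ * w + j * s + i * (h + 1) * (μ + τ * h + j * h) + τ ≡ (i * (h + 1) + 2 * h) * (μ + τ * h + j * h)
      polynomial h μ s w refl refl 1+w≡ = begin
        h * 2 * μ + τ * w + j * (h * 2 * h) + i * (h + 1) * (μ + τ * h + j * h) + τ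
          ≡⟨ solve (h ∷ μ ∷ w ∷ τ ∷ i ∷ j ∷ []) ⟩
        h * 2 * μ + τ * suc w + j * (h * 2 * h) + i * (h + 1) * (μ + τ * h + j * h)
          ≡⟨ cong (λ v → h * 2 * μ + τ * v + j * (h * 2 * h) + i * (h + 1) * (μ + τ * h + j * h)) 1+w≡ ⟩
        h * 2 * μ + τ * (h * 2 * h) + j * (h * 2 * h) + i * (h + 1) * (μ + τ * h + j * h)
          ≡⟨ solve (h ∷ μ ∷ τ ∷ i ∷ j ∷ []) ⟩
        (i * (h + 1) + 2 * h) * (μ + τ * h + j * h)
          ∎
        where open ≡-Reasoning

    SIJ-conductor : IsConductor (SIJ p τ i j) (cIJ p τ i j)
    SIJ-conductor = consecutive-conductor {i = i} {τ} ⦃ p/2≢0 ⦄ gIJ+dIJ≡ p/2*dIJ+2≡mIJ 3+τ≤dIJ cIJ+τ≡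
      where
      3+τ≤dIJ : 3 + τ ≤ dIJ p τ j
      3+τ≤dIJ = ≤-trans (n≤1+n (3 + τ)) (≤-trans (+-monoˡ-≤ τ (m≤n+m 4 (p / 2))) (m≤m+n _ j))

SIJ₀₀≡S : ∀ p τ → SIJ p τ 0 0 ≡ S p τ
SIJ₀₀≡S p τ rewrite +-identityʳ (mP p τ) | +-identityʳ (gP p τ + 0) | +-identityʳ (gP p τ)
                  | +-identityʳ (cP p τ + 0) | +-identityʳ (cP p τ) = refl

S-conductor : ∀ {p} → 2 ∣ p → 0 < p → ∀ τ → IsConductor (S p τ) (cP p τ)
S-conductor {p} 2∣p 0<p τ =
  subst₂ IsConductor (SIJ₀₀≡S p τ) (trans (+-identityʳ _) (+-identityʳ _)) (SIJ-conductor 2∣p 0<p τ 0 0)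

proposition5p4 : (p τ i j : ℕ) → 2 ∣ p → 0 < p → (cS : ℕ) → IsConductor (S p τ) cS →
    IsConductor (SIJ p τ i j) (cS + j * ((p * p) / 2) + i * (p / 2 + 1) * (mP p τ + j * (p / 2)))
proposition5p4 p τ i j 2∣p 0<p cS cS-conductor = subst
  (λ c → IsConductor (SIJ p τ i j) (c + j * ((p * p) / 2) + i * (p / 2 + 1) * (mP p τ + j * (p / 2))))
  (IsConductor-unique (S-conductor 2∣p 0<p τ) cS-conductor)
  (SIJ-conductor 2∣p 0<p τ i j)
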